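{- Let $\alpha_1,\ldots,\alpha_k,\alpha$ be simple types. Every total numerical function $f:\mathbb{N}^k\to\mathbb{N}$ that is $(\alpha_1,\ldots,\alpha_k,\alpha)$-definable in the $\lambda\Omega$-calculus is $(\alpha_1,\ldots,\alpha_k,\alpha)$-definable in the typed $\lambda\beta\eta$-calculus.
   Context: Simple types are built from a single ground type $o$ using $\to$. The typed $\lambda\beta\eta$-calculus is taken in Church style (each variable carries its type). For a type $\alpha$ let $\omega_\alpha=(\alpha\to\alpha)\to(\alpha\to\alpha)$ and $\underline{m}_\alpha=\lambda f^{\alpha\to\alpha}.\lambda x^\alpha.f^m(x)$. The $\lambda\Omega$-calculus is the typed $\lambda\beta\eta$-calculus extended with one constant $\Omega:o$ and no additional conversion rules. In an extension $\lambda^+$ of the $\lambda\beta\eta$-calculus, a closed term $F:\omega_{\alpha_1}\to\cdots\to\omega_{\alpha_k}\to\omega_\alpha$ $(\alpha_1,\ldots,\alpha_k,\alpha)$-defines a partial function $f:\mathbb{N}^k\rightharpoonup\mathbb{N}$ iff for all $m_1,\ldots,m_k,m$: $f(m_1,\ldots,m_k)$ is defined and equals $m$ iff $\vdash_{\lambda^+}F\,\underline{m_1}_{\alpha_1}\cdots\underline{m_k}_{\alpha_k}=\underline{m}_\alpha$. -}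

module Defs where

open import Data.Nat using (ℕ; zero; suc)
open import Data.Vec using (Vec; []; _∷_)
open import Data.Maybe using (Maybe; just)
open import Data.Product using (Σ; _×_)
open import Data.Empty using (⊥)
open import Relation.Binary.PropositionalEquality using (_≡_)
open import Function.Bundles using (_⇔_)

infixr 7 _⇒_
data Ty : Set where
  o   : Ty
  _⇒_ : Ty → Ty → Ty

infixl 5 _▹_
data Ctx : Set where
  ε   : Ctx
  _▹_ : Ctx → Ty → Ctx

infix 4 _∋_
data _∋_ : Ctx → Ty → Set where
  here  : ∀ {Γ A} → Γ ▹ A ∋ A
  there : ∀ {Γ A B} → Γ ∋ A → Γ ▹ B ∋ A

data Tm (Const : Ty → Set) (Γ : Ctx) : Ty → Set where
  var : ∀ {A} → Γ ∋ A → Tm Const Γ A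
  con : ∀ {A} → Const A → Tm Const Γ A
  lam : ∀ {A B} → Tm Const (Γ ▹ A) B → Tm Const Γ (A ⇒ B)
  app : ∀ {A B} → Tm Const Γ (A ⇒ B) → Tm Const Γ A → Tm Const Γ B

module _ {Const : Ty → Set} where

  Ren : Ctx → Ctx → Set
  Ren Γ Δ = ∀ {A} → Γ ∋ A → Δ ∋ A

  extR : ∀ {Γ Δ B} → Ren Γ Δ → Ren (Γ ▹ B) (Δ ▹ B)
  extR ρ here      = here
  extR ρ (there x) = there (ρ x)

  ren : ∀ {Γ Δ A} → Ren Γ Δ → Tm Const Γ A → Tm Const Δ A
  ren ρ (var x)   = var (ρ x)
  ren ρ (con c)   = con c
  ren ρ (lam t)   = lam (ren (extR ρ) t)
  ren ρ (app t u) = app (ren ρ t) (ren ρ u)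

  Sub : Ctx → Ctx → Set
  Sub Γ Δ = ∀ {A} → Γ ∋ A → Tm Const Δ A

  extS : ∀ {Γ Δ B} → Sub Γ Δ → Sub (Γ ▹ B) (Δ ▹ B)
  extS σ here      = var here
  extS σ (there x) = ren there (σ x)

  sub : ∀ {Γ Δ A} → Sub Γ Δ → Tm Const Γ A → Tm Const Δ A
  sub σ (var x)   = σ x
  sub σ (con c)   = con c
  sub σ (lam t)   = lam (sub (extS σ) t)
  sub σ (app t u) = app (sub σ t) (sub σ u)

  single : ∀ {Γ B} → Tm Const Γ B → Sub (Γ ▹ B) Γ
  single u here      = u
  single u (there x) = var x

  _[_] : ∀ {Γ A B} → Tm Const (Γ ▹ B) A → Tm Const Γ B → Tm Const Γ A
  t [ u ] = sub (single u) t

  wk : ∀ {Γ A B} → Tm Const Γ A → Tm Const (Γ ▹ B) A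
  wk = ren there

-- βη-convertibility: the least congruence (equivalence) containing β and η.
-- No further conversion rules for constants.
infix 4 _≈βη_
data _≈βη_ {Const : Ty → Set} {Γ : Ctx} : ∀ {A} → Tm Const Γ A → Tm Const Γ A → Set where
  ≈refl  : ∀ {A} {t : Tm Const Γ A} → t ≈βη t
  ≈sym   : ∀ {A} {t u : Tm Const Γ A} → t ≈βη u → u ≈βη t
  ≈trans : ∀ {A} {t u v : Tm Const Γ A} → t ≈βη u → u ≈βη v → t ≈βη v
  ≈app   : ∀ {A B} {t t′ : Tm Const Γ (A ⇒ B)} {u u′ : Tm Const Γ A} →
           t ≈βη t′ → u ≈βη u′ → app t u ≈βη app t′ u′
  ≈lam   : ∀ {A B} {t t′ : Tm Const (Γ ▹ A) B} → t ≈βη t′ → lam t ≈βη lam t′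
  ≈β     : ∀ {A B} (t : Tm Const (Γ ▹ A) B) (u : Tm Const Γ A) → app (lam t) u ≈βη t [ u ]
  ≈η     : ∀ {A B} (t : Tm Const Γ (A ⇒ B)) → t ≈βη lam (app (wk t) (var here))

NoConst : Ty → Set
NoConst _ = ⊥

data ΩConst : Ty → Set where
  Ω : ΩConst o

ω : Ty → Ty
ω α = (α ⇒ α) ⇒ (α ⇒ α)

iterf : ∀ {Const α} → ℕ → Tm Const (ε ▹ (α ⇒ α) ▹ α) α
iterf zero    = var here
iterf (suc m) = app (var (there here)) (iterf m)

num : ∀ {Const} (α : Ty) → ℕ → Tm Const ε (ω α)
num α m = lam (lam (iterf m))

Arity : ∀ {k} → Vec Ty k → Ty → Ty
Arity []       α = ω α
Arity (a ∷ as) α = ω a ⇒ Arity as α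

applyNums : ∀ {Const k} {as : Vec Ty k} {α} →
            Tm Const ε (Arity as α) → Vec ℕ k → Tm Const ε (ω α)
applyNums {as = []}     F []       = F
applyNums {as = a ∷ as} F (m ∷ ms) = applyNums (app F (num a m)) ms

Defines : ∀ (Const : Ty → Set) {k} (as : Vec Ty k) (α : Ty) →
          Tm Const ε (Arity as α) → (Vec ℕ k → Maybe ℕ) → Set
Defines Const {k} as α F f =
  ∀ (ms : Vec ℕ k) (m : ℕ) → (f ms ≡ just m) ⇔ (applyNums F ms ≈βη num α m)

Definable : ∀ (Const : Ty → Set) {k} (as : Vec Ty k) (α : Ty) → (Vec ℕ k → Maybe ℕ) → Set
Definable Const as α f = Σ (Tm Const ε (Arity as α)) (λ F → Defines Const as α F f)

{-# OPTIONS --safe #-}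
-- Substitute for Ω a default ground value manufactured from the numeral's own
-- bound variable x : α, namely x applied to the variables of an η-expansion of
-- the result down to o.  Substitution of constants respects βη and fixes pure
-- terms, so the translated term maps numerals to the same numerals as F.  The
-- converse half of definability needs that distinct numerals are not
-- βη-convertible, which the set-theoretic model (with extensional equality as
-- a logical relation, to validate η) shows by evaluating at successor and zero.
module Submission where

open import Defs
open import Data.Nat using (ℕ; zero; suc)
open import Data.Vec using (Vec; []; _∷_)
open import Data.Maybe using (just)
open import Data.Maybe.Properties using (just-injective)
open import Data.Product using (_,_)
open import Function using (_∘_)
open import Function.Bundles using (mk⇔; Equivalence)
open import Relation.Binary.Bundles using (Setoid)
open import Relation.Binary.PropositionalEquality hiding ([_])
import Relation.Binary.Reasoning.Setoid as SetoidReasoning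

-- Simultaneous substitution of constants and variables

Interp : (Ty → Set) → (Ty → Set) → Ctx → Set
Interp C D Δ = ∀ {B} → C B → Tm D Δ B

gsub : ∀ {C D Γ Δ A} → Interp C D Δ → Sub {D} Γ Δ → Tm C Γ A → Tm D Δ A
gsub κ σ (var x)   = σ x
gsub κ σ (con c)   = κ c
gsub κ σ (lam t)   = lam (gsub (wk ∘ κ) (extS σ) t)
gsub κ σ (app t u) = app (gsub κ σ t) (gsub κ σ u)

≈βη-setoid : (Ty → Set) → Ctx → Ty → Setoid _ _
≈βη-setoid C Γ A = record
  { Carrier       = Tm C Γ A
  ; _≈_           = _≈βη_
  ; isEquivalence = record { refl = ≈refl ; sym = ≈sym ; trans = ≈trans }
  }

≡⇒≈βη : ∀ {C Γ A} {t u : Tm C Γ A} → t ≡ u → t ≈βη u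
≡⇒≈βη refl = ≈refl

gsub-cong : ∀ {C D Γ Δ A} {κ κ′ : Interp C D Δ} {σ σ′ : Sub {D} Γ Δ} →
            (∀ {B} (c : C B) → κ c ≡ κ′ c) → (∀ {B} (x : Γ ∋ B) → σ x ≡ σ′ x) →
            (t : Tm C Γ A) → gsub κ σ t ≡ gsub κ′ σ′ t
gsub-cong hκ hσ (var x)   = hσ x
gsub-cong hκ hσ (con c)   = hκ c
gsub-cong hκ hσ (lam t)   =
  cong lam (gsub-cong (cong wk ∘ hκ) (λ { here → refl ; (there x) → cong wk (hσ x) }) t)
gsub-cong hκ hσ (app t u) = cong₂ app (gsub-cong hκ hσ t) (gsub-cong hκ hσ u)

gsub-id : ∀ {C Γ A} {κ : Interp C C Γ} {σ : Sub {C} Γ Γ} →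
          (∀ {B} (c : C B) → κ c ≡ con c) → (∀ {B} (x : Γ ∋ B) → σ x ≡ var x) →
          (t : Tm C Γ A) → gsub κ σ t ≡ t
gsub-id hκ hσ (var x)   = hσ x
gsub-id hκ hσ (con c)   = hκ c
gsub-id hκ hσ (lam t)   =
  cong lam (gsub-id (cong wk ∘ hκ) (λ { here → refl ; (there x) → cong wk (hσ x) }) t)
gsub-id hκ hσ (app t u) = cong₂ app (gsub-id hκ hσ t) (gsub-id hκ hσ u)

ren-cong : ∀ {C Γ Δ A} {ρ ρ′ : Ren {C} Γ Δ} →
           (∀ {B} (x : Γ ∋ B) → ρ x ≡ ρ′ x) → (t : Tm C Γ A) → ren ρ t ≡ ren ρ′ t
ren-cong h (var x)   = cong var (h x)
ren-cong h (con c)   = refl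
ren-cong h (lam t)   = cong lam (ren-cong (λ { here → refl ; (there x) → cong there (h x) }) t)
ren-cong h (app t u) = cong₂ app (ren-cong h t) (ren-cong h u)

ren-ren : ∀ {C Γ Δ Θ A} (ρ : Ren {C} Δ Θ) (ρ′ : Ren {C} Γ Δ) (t : Tm C Γ A) →
          ren ρ (ren ρ′ t) ≡ ren (ρ ∘ ρ′) t
ren-ren ρ ρ′ (var x)   = refl
ren-ren ρ ρ′ (con c)   = refl
ren-ren ρ ρ′ (lam t)   =
  cong lam (trans (ren-ren (extR ρ) (extR ρ′) t) (ren-cong (λ { here → refl ; (there x) → refl }) t))
ren-ren ρ ρ′ (app t u) = cong₂ app (ren-ren ρ ρ′ t) (ren-ren ρ ρ′ u)

ren≡gsub : ∀ {C Γ Δ A} (ρ : Ren {C} Γ Δ) (t : Tm C Γ A) → ren ρ t ≡ gsub con (var ∘ ρ) t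
ren≡gsub ρ (var x)   = refl
ren≡gsub ρ (con c)   = refl
ren≡gsub ρ (lam t)   =
  cong lam (trans (ren≡gsub (extR ρ) t)
                  (gsub-cong (λ c → refl) (λ { here → refl ; (there x) → refl }) t))
ren≡gsub ρ (app t u) = cong₂ app (ren≡gsub ρ t) (ren≡gsub ρ u)

sub≡gsub : ∀ {C Γ Δ A} (σ : Sub {C} Γ Δ) (t : Tm C Γ A) → sub σ t ≡ gsub con σ t
sub≡gsub σ (var x)   = refl
sub≡gsub σ (con c)   = refl
sub≡gsub σ (lam t)   = cong lam (sub≡gsub (extS σ) t)
sub≡gsub σ (app t u) = cong₂ app (sub≡gsub σ t) (sub≡gsub σ u)

gsub-ren : ∀ {C D Γ Γ′ Δ A} (κ : Interp C D Δ) (σ : Sub {D} Γ′ Δ) (ρ : Ren {C} Γ Γ′)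
           (t : Tm C Γ A) → gsub κ σ (ren ρ t) ≡ gsub κ (σ ∘ ρ) t
gsub-ren κ σ ρ (var x)   = refl
gsub-ren κ σ ρ (con c)   = refl
gsub-ren κ σ ρ (lam t)   = cong lam (trans (gsub-ren (wk ∘ κ) (extS σ) (extR ρ) t)
  (gsub-cong (λ c → refl) (λ { here → refl ; (there x) → refl }) t))
gsub-ren κ σ ρ (app t u) = cong₂ app (gsub-ren κ σ ρ t) (gsub-ren κ σ ρ u)

ren-gsub : ∀ {C D Γ Δ Θ A} (ρ : Ren {D} Δ Θ) (κ : Interp C D Δ) (σ : Sub {D} Γ Δ)
           (t : Tm C Γ A) → ren ρ (gsub κ σ t) ≡ gsub (ren ρ ∘ κ) (ren ρ ∘ σ) t
ren-gsub ρ κ σ (var x)   = refl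
ren-gsub ρ κ σ (con c)   = refl
ren-gsub ρ κ σ (lam t)   = cong lam (trans (ren-gsub (extR ρ) (wk ∘ κ) (extS σ) t)
  (gsub-cong (ren-extR-wk ∘ κ) (λ { here → refl ; (there x) → ren-extR-wk (σ x) }) t))
  where
  ren-extR-wk : ∀ {B E} (u : Tm _ _ B) → ren (extR {B = E} ρ) (wk u) ≡ wk (ren ρ u)
  ren-extR-wk u = trans (ren-ren (extR ρ) there u) (sym (ren-ren there ρ u))
ren-gsub ρ κ σ (app t u) = cong₂ app (ren-gsub ρ κ σ t) (ren-gsub ρ κ σ u)

gsub-wk : ∀ {C D Γ Δ A B} (κ : Interp C D Δ) (σ : Sub {D} Γ Δ) (t : Tm C Γ A) →
          gsub (wk {B = B} ∘ κ) (extS σ) (wk t) ≡ wk (gsub κ σ t)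
gsub-wk κ σ t = trans (gsub-ren (wk ∘ κ) (extS σ) there t) (sym (ren-gsub there κ σ t))

gsub-gsub : ∀ {C D E Γ Δ Θ A} (κ′ : Interp D E Θ) (σ′ : Sub {E} Δ Θ)
            (κ : Interp C D Δ) (σ : Sub {D} Γ Δ) (t : Tm C Γ A) →
            gsub κ′ σ′ (gsub κ σ t) ≡ gsub (gsub κ′ σ′ ∘ κ) (gsub κ′ σ′ ∘ σ) t
gsub-gsub κ′ σ′ κ σ (var x)   = refl
gsub-gsub κ′ σ′ κ σ (con c)   = refl
gsub-gsub κ′ σ′ κ σ (lam t)   = cong lam (trans
  (gsub-gsub (wk ∘ κ′) (extS σ′) (wk ∘ κ) (extS σ) t)
  (gsub-cong (gsub-wk κ′ σ′ ∘ κ) (λ { here → refl ; (there x) → gsub-wk κ′ σ′ (σ x) }) t))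
gsub-gsub κ′ σ′ κ σ (app t u) = cong₂ app (gsub-gsub κ′ σ′ κ σ t) (gsub-gsub κ′ σ′ κ σ u)

gsub-single-wk : ∀ {C Γ A B} (v : Tm C Γ B) (w : Tm C Γ A) → gsub con (single v) (wk w) ≡ w
gsub-single-wk v w = trans (gsub-ren con (single v) there w) (gsub-id (λ c → refl) (λ x → refl) w)

gsub-[] : ∀ {C D Γ Δ A B} (κ : Interp C D Δ) (σ : Sub {D} Γ Δ)
          (t : Tm C (Γ ▹ B) A) (u : Tm C Γ B) →
          gsub (wk ∘ κ) (extS σ) t [ gsub κ σ u ] ≡ gsub κ σ (t [ u ])
gsub-[] κ σ t u = begin
  gsub (wk ∘ κ) (extS σ) t [ v ]
    ≡⟨ sub≡gsub (single v) (gsub (wk ∘ κ) (extS σ) t) ⟩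
  gsub con (single v) (gsub (wk ∘ κ) (extS σ) t)
    ≡⟨ gsub-gsub con (single v) (wk ∘ κ) (extS σ) t ⟩
  gsub (gsub con (single v) ∘ wk ∘ κ) (gsub con (single v) ∘ extS σ) t
    ≡⟨ gsub-cong (gsub-single-wk v ∘ κ)
                 (λ { here → refl ; (there x) → gsub-single-wk v (σ x) }) t ⟩
  gsub (gsub κ σ ∘ con) (gsub κ σ ∘ single u) t
    ≡⟨ gsub-gsub κ σ con (single u) t ⟨
  gsub κ σ (gsub con (single u) t)
    ≡⟨ cong (gsub κ σ) (sub≡gsub (single u) t) ⟨
  gsub κ σ (t [ u ]) ∎
  where
  open ≡-Reasoning
  v = gsub κ σ u

gsub-≈βη : ∀ {C D Γ Δ A} (κ : Interp C D Δ) (σ : Sub {D} Γ Δ) {t u : Tm C Γ A} →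
           t ≈βη u → gsub κ σ t ≈βη gsub κ σ u
gsub-≈βη κ σ ≈refl          = ≈refl
gsub-≈βη κ σ (≈sym e)       = ≈sym (gsub-≈βη κ σ e)
gsub-≈βη κ σ (≈trans e e′)  = ≈trans (gsub-≈βη κ σ e) (gsub-≈βη κ σ e′)
gsub-≈βη κ σ (≈app e e′)    = ≈app (gsub-≈βη κ σ e) (gsub-≈βη κ σ e′)
gsub-≈βη κ σ (≈lam e)       = ≈lam (gsub-≈βη (wk ∘ κ) (extS σ) e)
gsub-≈βη κ σ (≈β t u)       = ≈trans (≈β _ _) (≡⇒≈βη (gsub-[] κ σ t u))
gsub-≈βη κ σ (≈η t)         =
  ≈trans (≈η _) (≡⇒≈βη (cong (λ s → lam (app s (var here))) (sym (gsub-wk κ σ t))))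

ren-≈βη : ∀ {C Γ Δ A} (ρ : Ren {C} Γ Δ) {t u : Tm C Γ A} → t ≈βη u → ren ρ t ≈βη ren ρ u
ren-≈βη ρ {t} {u} e =
  subst₂ _≈βη_ (sym (ren≡gsub ρ t)) (sym (ren≡gsub ρ u)) (gsub-≈βη con (var ∘ ρ) e)

-- Numerals

iter : ∀ {C Γ α} → Tm C Γ (α ⇒ α) → Tm C Γ α → ℕ → Tm C Γ α
iter f x zero    = x
iter f x (suc m) = app f (iter f x m)

iterf≡iter : ∀ {C α} (m : ℕ) → iterf {C} {α} m ≡ iter (var (there here)) (var here) m
iterf≡iter zero    = refl
iterf≡iter (suc m) = cong (app (var (there here))) (iterf≡iter m)

iter-homomorphic : ∀ {C D Γ Δ α} (h : ∀ {A} → Tm C Γ A → Tm D Δ A) →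
                   (∀ {A B} (t : Tm C Γ (A ⇒ B)) u → h (app t u) ≡ app (h t) (h u)) →
                   (f : Tm C Γ (α ⇒ α)) (x : Tm C Γ α) (m : ℕ) →
                   h (iter f x m) ≡ iter (h f) (h x) m
iter-homomorphic h h-app f x zero    = refl
iter-homomorphic h h-app f x (suc m) =
  trans (h-app f (iter f x m)) (cong (app (h f)) (iter-homomorphic h h-app f x m))

applyNums-≈βη : ∀ {C k} {as : Vec Ty k} {α} {G G′ : Tm C ε (Arity as α)} →
                G ≈βη G′ → (ms : Vec ℕ k) → applyNums G ms ≈βη applyNums G′ ms
applyNums-≈βη {as = []}     e []       = e
applyNums-≈βη {as = a ∷ as} e (m ∷ ms) = applyNums-≈βη (≈app e ≈refl) ms

iterf-gsub : ∀ {C D α} (κ : Interp C D (ε ▹ (α ⇒ α) ▹ α))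
             (σ : Sub {D} (ε ▹ (α ⇒ α) ▹ α) (ε ▹ (α ⇒ α) ▹ α)) →
             σ here ≡ var here → σ (there here) ≡ var (there here) →
             (m : ℕ) → gsub κ σ (iterf {C} m) ≡ iterf m
iterf-gsub κ σ σ-x σ-f zero    = σ-x
iterf-gsub κ σ σ-x σ-f (suc m) = cong₂ app σ-f (iterf-gsub κ σ σ-x σ-f m)

-- Eliminating Ω

embed : ∀ {Γ A} → Tm NoConst Γ A → Tm ΩConst Γ A
embed = gsub (λ ()) var

wk-embed : ∀ {Γ A B} (t : Tm NoConst Γ A) → wk {B = B} (embed t) ≡ embed (wk t)
wk-embed t = trans (ren-gsub there (λ ()) var t)
  (trans (gsub-cong (λ ()) (λ x → refl) t) (sym (gsub-ren (λ ()) var there t)))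

gsub-embed : ∀ {Γ A} (κ : Interp ΩConst NoConst Γ) (t : Tm NoConst Γ A) →
             gsub κ var (embed t) ≡ t
gsub-embed κ t = trans (gsub-gsub κ var (λ ()) var t) (gsub-id (λ ()) (λ x → refl) t)

extS-embed : ∀ {Γ Δ A} (σ : Sub {NoConst} Γ Δ) (σ′ : Sub {ΩConst} Γ Δ) →
             (∀ {B} (x : Γ ∋ B) → σ′ x ≡ embed (σ x)) →
             ∀ {B} (x : Γ ▹ A ∋ B) → extS σ′ x ≡ embed (extS σ x)
extS-embed σ σ′ h here      = refl
extS-embed σ σ′ h (there x) = trans (cong wk (h x)) (wk-embed (σ x))

embed-num : ∀ α m → embed (num {NoConst} α m) ≡ num α m
embed-num α m = cong (lam ∘ lam) (iterf-gsub _ _ refl refl m)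

Ω↦ : ∀ {Δ} → Tm NoConst Δ o → Interp ΩConst NoConst Δ
Ω↦ s Ω = s

-- At B = B₁ ⇒ ⋯ ⇒ Bₙ ⇒ o, fill B s t is λ v⃗. t v⃗ with Ω replaced by s v⃗.
fill : ∀ {Δ} B → Tm NoConst Δ B → Tm ΩConst Δ B → Tm NoConst Δ B
fill o       s t = gsub (Ω↦ s) var t
fill (A ⇒ B) s t = lam (fill B (app (wk s) (var here)) (app (wk t) (var here)))

fillNum : ∀ {Γ} α → Tm ΩConst Γ (ω α) → Tm NoConst Γ (ω α)
fillNum α t = lam (lam (fill α (var here) (app (app (wk (wk t)) (var (there here))) (var here))))

translate : ∀ {Γ k} (as : Vec Ty k) α → Tm ΩConst Γ (Arity as α) → Tm NoConst Γ (Arity as α)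
translate []       α G = fillNum α G
translate (a ∷ as) α G = lam (translate as α (app (wk G) (var here)))

fill-≈βη : ∀ {Δ} B (s : Tm NoConst Δ B) {t t′ : Tm ΩConst Δ B} →
           t ≈βη t′ → fill B s t ≈βη fill B s t′
fill-≈βη o       s e = gsub-≈βη (Ω↦ s) var e
fill-≈βη (A ⇒ B) s e = ≈lam (fill-≈βη B _ (≈app (ren-≈βη there e) ≈refl))

fillNum-≈βη : ∀ {Γ} α {t t′ : Tm ΩConst Γ (ω α)} → t ≈βη t′ → fillNum α t ≈βη fillNum α t′
fillNum-≈βη α e =
  ≈lam (≈lam (fill-≈βη α _ (≈app (≈app (ren-≈βη there (ren-≈βη there e)) ≈refl) ≈refl)))

fill-embed : ∀ {Δ} B (s t : Tm NoConst Δ B) → fill B s (embed t) ≈βη t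
fill-embed o       s t = ≡⇒≈βη (gsub-embed (Ω↦ s) t)
fill-embed (A ⇒ B) s t = ≈trans (≈lam (≈trans
  (≡⇒≈βη (cong (λ u → fill B (app (wk s) (var here)) (app u (var here))) (wk-embed t)))
  (fill-embed B _ (app (wk t) (var here))))) (≈sym (≈η t))

fill-gsub : ∀ {Γ Δ} B (σ : Sub {NoConst} Γ Δ) (σ′ : Sub {ΩConst} Γ Δ) →
            (∀ {B} (x : Γ ∋ B) → σ′ x ≡ embed (σ x)) →
            (s : Tm NoConst Γ B) (t : Tm ΩConst Γ B) →
            gsub con σ (fill B s t) ≡ fill B (gsub con σ s) (gsub con σ′ t)
fill-gsub o σ σ′ h s t = begin
  gsub con σ (gsub (Ω↦ s) var t)
    ≡⟨ gsub-gsub con σ (Ω↦ s) var t ⟩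
  gsub (gsub con σ ∘ Ω↦ s) σ t
    ≡⟨ gsub-cong (λ { Ω → refl }) (λ x → sym (gsub-embed-at x)) t ⟩
  gsub (gsub κ var ∘ con) (gsub κ var ∘ σ′) t
    ≡⟨ gsub-gsub κ var con σ′ t ⟨
  gsub κ var (gsub con σ′ t) ∎
  where
  open ≡-Reasoning
  κ = Ω↦ (gsub con σ s)
  gsub-embed-at : ∀ {B} (x : _ ∋ B) → gsub κ var (σ′ x) ≡ σ x
  gsub-embed-at x = trans (cong (gsub κ var) (h x)) (gsub-embed κ (σ x))
fill-gsub (A ⇒ B) σ σ′ h s t =
  cong lam (trans (fill-gsub B (extS σ) (extS σ′) (extS-embed σ σ′ h) _ _)
    (cong₂ (λ s′ t′ → fill B (app s′ (var here)) (app t′ (var here)))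
      (gsub-wk con σ s) (gsub-wk con σ′ t)))

translate-gsub : ∀ {Γ Δ k} (as : Vec Ty k) α (σ : Sub {NoConst} Γ Δ) (σ′ : Sub {ΩConst} Γ Δ) →
                 (∀ {B} (x : Γ ∋ B) → σ′ x ≡ embed (σ x)) →
                 (G : Tm ΩConst Γ (Arity as α)) →
                 gsub con σ (translate as α G) ≡ translate as α (gsub con σ′ G)
translate-gsub [] α σ σ′ h G =
  cong (lam ∘ lam) (trans
    (fill-gsub α (extS (extS σ)) (extS (extS σ′)) (extS-embed _ _ (extS-embed σ σ′ h)) _ _)
    (cong (λ u → fill α (var here) (app (app u (var (there here))) (var here)))
      (trans (gsub-wk con (extS σ′) (wk G)) (cong wk (gsub-wk con σ′ G)))))
translate-gsub (a ∷ as) α σ σ′ h G =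
  cong lam (trans (translate-gsub as α (extS σ) (extS σ′) (extS-embed σ σ′ h) _)
    (cong (λ u → translate as α (app u (var here))) (gsub-wk con σ′ G)))

applyNums-translate : ∀ {k} (as : Vec Ty k) α (G : Tm ΩConst ε (Arity as α)) (ms : Vec ℕ k) →
                      applyNums (translate as α G) ms ≈βη fillNum α (applyNums G ms)
applyNums-translate []       α G []       = ≈refl
applyNums-translate (a ∷ as) α G (m ∷ ms) =
  ≈trans (applyNums-≈βη (≈trans (≈β _ _) (≡⇒≈βη β-translate)) ms)
         (applyNums-translate as α (app G (num a m)) ms)
  where
  β-translate : translate as α (app (wk G) (var here)) [ num a m ] ≡
                translate as α (app G (num a m))
  β-translate = trans (sub≡gsub _ (translate as α (app (wk G) (var here))))
    (trans (translate-gsub as α (single (num a m)) (single (num a m))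
             (λ { here → sym (embed-num a m) ; (there ()) }) _)
      (cong (λ u → translate as α (app u (num a m))) (gsub-single-wk (num a m) G)))

fillNum-num : ∀ α m → fillNum α (num α m) ≈βη num α m
fillNum-num α m = ≈lam (≈lam (begin
  fill α (var here) (app (app (wk (wk (num α m))) (var (there here))) (var here))
    ≈⟨ fill-≈βη α (var here) applied-num ⟩
  fill α (var here) (iterf m)
    ≡⟨ cong (fill α (var here)) (iterf-gsub _ var refl refl m) ⟨
  fill α (var here) (embed (iterf m))
    ≈⟨ fill-embed α (var here) (iterf m) ⟩
  iterf m ∎))
  where
  Γ = ε ▹ (α ⇒ α) ▹ α
  open SetoidReasoning (≈βη-setoid NoConst Γ α)
  reduct : ∀ {A} → Tm ΩConst Γ A → Tm ΩConst Γ A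
  reduct t = sub (extS (single (var (there here))))
                 (ren (extR (extR there)) (ren (extR (extR there)) t)) [ var here ]
  reduct-iterf : reduct (iterf m) ≡ iterf m
  reduct-iterf = trans (cong reduct (iterf≡iter m))
    (trans (iter-homomorphic reduct (λ _ _ → refl) _ _ m) (sym (iterf≡iter m)))
  applied-num : app (app (wk (wk (num α m))) (var (there here))) (var here) ≈βη iterf m
  applied-num = ≈trans (≈app (≈β _ _) ≈refl) (≈trans (≈β _ _) (≡⇒≈βη reduct-iterf))

-- Distinct numerals are not βη-convertible

⟦_⟧ : Ty → Set
⟦ o ⟧     = ℕ
⟦ A ⇒ B ⟧ = ⟦ A ⟧ → ⟦ B ⟧

Env : Ctx → Set
Env Γ = ∀ {A} → Γ ∋ A → ⟦ A ⟧

∅ : Env ε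
∅ ()

infixl 5 _,,_
_,,_ : ∀ {Γ A} → Env Γ → ⟦ A ⟧ → Env (Γ ▹ A)
(ρ ,, a) here      = a
(ρ ,, a) (there x) = ρ x

eval : ∀ {Γ A} → Tm NoConst Γ A → Env Γ → ⟦ A ⟧
eval (var x)   ρ = ρ x
eval (lam t)   ρ = λ a → eval t (ρ ,, a)
eval (app t u) ρ = eval t ρ (eval u ρ)

Ext : ∀ A → ⟦ A ⟧ → ⟦ A ⟧ → Set
Ext o       a b = a ≡ b
Ext (A ⇒ B) f g = ∀ a b → Ext A a b → Ext B (f a) (g b)

Ext-sym : ∀ A {a b} → Ext A a b → Ext A b a
Ext-sym o       r = sym r
Ext-sym (A ⇒ B) r a b rab = Ext-sym B (r b a (Ext-sym A rab))

Ext-trans : ∀ A {a b c} → Ext A a b → Ext A b c → Ext A a c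
Ext-trans o       r s = trans r s
Ext-trans (A ⇒ B) r s a c rac = Ext-trans B (r a c rac) (s c c (Ext-trans A (Ext-sym A rac) rac))

Ext-reflʳ : ∀ A {a b} → Ext A a b → Ext A b b
Ext-reflʳ A r = Ext-trans A (Ext-sym A r) r

EnvExt : ∀ {Γ} → Env Γ → Env Γ → Set
EnvExt {Γ} ρ ρ′ = ∀ {A} (x : Γ ∋ A) → Ext A (ρ x) (ρ′ x)

EnvExt-,, : ∀ {Γ A} {ρ ρ′ : Env Γ} {a b} →
            EnvExt ρ ρ′ → Ext A a b → EnvExt (ρ ,, a) (ρ′ ,, b)
EnvExt-,, h r here      = r
EnvExt-,, h r (there x) = h x

eval-Ext : ∀ {Γ A} (t : Tm NoConst Γ A) {ρ ρ′ : Env Γ} →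
           EnvExt ρ ρ′ → Ext A (eval t ρ) (eval t ρ′)
eval-Ext (var x)   h = h x
eval-Ext (lam t)   h a b r = eval-Ext t (EnvExt-,, h r)
eval-Ext (app t u) h = eval-Ext t h _ _ (eval-Ext u h)

eval-ren : ∀ {Γ Δ A} (ρ : Ren {NoConst} Γ Δ) (t : Tm NoConst Γ A) {γ : Env Γ} {δ : Env Δ} →
           (∀ {B} (x : Γ ∋ B) → Ext B (γ x) (δ (ρ x))) → Ext A (eval t γ) (eval (ren ρ t) δ)
eval-ren ρ (var x)   h = h x
eval-ren ρ (lam t)   h a b r = eval-ren (extR ρ) t (λ { here → r ; (there x) → h x })
eval-ren ρ (app t u) h = eval-ren ρ t h _ _ (eval-ren ρ u h)

eval-sub : ∀ {Γ Δ A} (σ : Sub {NoConst} Γ Δ) (t : Tm NoConst Γ A) {γ : Env Γ} {δ : Env Δ} →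
           (∀ {B} (x : Γ ∋ B) → Ext B (γ x) (eval (σ x) δ)) → EnvExt δ δ →
           Ext A (eval t γ) (eval (sub σ t) δ)
eval-sub σ (var x)   h hδ = h x
eval-sub σ (lam t)   h hδ a b r = eval-sub (extS σ) t
  (λ { here → r ; (there {A = B} x) → Ext-trans B (h x) (eval-ren there (σ x) hδ) })
  (EnvExt-,, hδ (Ext-reflʳ _ r))
eval-sub σ (app t u) h hδ = eval-sub σ t h hδ _ _ (eval-sub σ u h hδ)

≈βη-sound : ∀ {Γ A} {t u : Tm NoConst Γ A} → t ≈βη u →
            {ρ ρ′ : Env Γ} → EnvExt ρ ρ′ → Ext A (eval t ρ) (eval u ρ′)
≈βη-sound {t = t} ≈refl h        = eval-Ext t h
≈βη-sound {A = A} (≈sym e) h     = Ext-sym A (≈βη-sound e (Ext-sym _ ∘ h))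
≈βη-sound {A = A} (≈trans e e′) h = Ext-trans A (≈βη-sound e h) (≈βη-sound e′ (Ext-reflʳ _ ∘ h))
≈βη-sound (≈app e e′) h          = ≈βη-sound e h _ _ (≈βη-sound e′ h)
≈βη-sound (≈lam e) h a b r       = ≈βη-sound e (EnvExt-,, h r)
≈βη-sound (≈β t u) h             =
  eval-sub (single u) t (λ { here → eval-Ext u h ; (there x) → h x }) (Ext-reflʳ _ ∘ h)
≈βη-sound {A = A ⇒ B} (≈η t) h a b r =
  Ext-trans B (eval-Ext t h a b r) (eval-ren there t (Ext-reflʳ _ ∘ h) b b (Ext-reflʳ A r))

zeroᵀ : ∀ A → ⟦ A ⟧
zeroᵀ o       = 0
zeroᵀ (A ⇒ B) = λ _ → zeroᵀ B

sucᵀ : ∀ A → ⟦ A ⟧ → ⟦ A ⟧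
sucᵀ o       = suc
sucᵀ (A ⇒ B) h = sucᵀ B ∘ h

readᵀ : ∀ A → ⟦ A ⟧ → ℕ
readᵀ o       n = n
readᵀ (A ⇒ B) h = readᵀ B (h (zeroᵀ A))

Ext-zeroᵀ : ∀ A → Ext A (zeroᵀ A) (zeroᵀ A)
Ext-zeroᵀ o       = refl
Ext-zeroᵀ (A ⇒ B) a b r = Ext-zeroᵀ B

Ext-sucᵀ : ∀ A → Ext (A ⇒ A) (sucᵀ A) (sucᵀ A)
Ext-sucᵀ o       a b r = cong suc r
Ext-sucᵀ (A ⇒ B) h h′ r a b rab = Ext-sucᵀ B (h a) (h′ b) (r a b rab)

readᵀ-Ext : ∀ A {a b} → Ext A a b → readᵀ A a ≡ readᵀ A b
readᵀ-Ext o       r = r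
readᵀ-Ext (A ⇒ B) r = readᵀ-Ext B (r _ _ (Ext-zeroᵀ A))

readᵀ-zeroᵀ : ∀ A → readᵀ A (zeroᵀ A) ≡ 0
readᵀ-zeroᵀ o       = refl
readᵀ-zeroᵀ (A ⇒ B) = readᵀ-zeroᵀ B

readᵀ-sucᵀ : ∀ A h → readᵀ A (sucᵀ A h) ≡ suc (readᵀ A h)
readᵀ-sucᵀ o       h = refl
readᵀ-sucᵀ (A ⇒ B) h = readᵀ-sucᵀ B (h (zeroᵀ A))

readᵀ-num : ∀ α m → readᵀ α (eval (num {NoConst} α m) ∅ (sucᵀ α) (zeroᵀ α)) ≡ m
readᵀ-num α zero    = readᵀ-zeroᵀ α
readᵀ-num α (suc m) = trans (readᵀ-sucᵀ α _) (cong suc (readᵀ-num α m))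

num-injective : ∀ α {m m′} → num {NoConst} α m ≈βη num α m′ → m ≡ m′
num-injective α {m} {m′} e = begin
  m                                               ≡⟨ readᵀ-num α m ⟨
  readᵀ α (eval (num α m) ∅ (sucᵀ α) (zeroᵀ α))   ≡⟨ readᵀ-Ext α related ⟩
  readᵀ α (eval (num α m′) ∅ (sucᵀ α) (zeroᵀ α))  ≡⟨ readᵀ-num α m′ ⟩
  m′                                              ∎
  where
  open ≡-Reasoning
  related : Ext α (eval (num α m) ∅ (sucᵀ α) (zeroᵀ α)) (eval (num α m′) ∅ (sucᵀ α) (zeroᵀ α))
  related = ≈βη-sound e (λ ()) _ _ (Ext-sucᵀ α) _ _ (Ext-zeroᵀ α)

lemma1 : ∀ {k} (as : Vec Ty k) (α : Ty) (f : Vec ℕ k → ℕ) →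
         Definable ΩConst as α (just ∘ f) → Definable NoConst as α (just ∘ f)
lemma1 as α f (F , F-defines-f) = F⁻ , λ ms m → mk⇔
  (λ fms≡m → subst (λ n → applyNums F⁻ ms ≈βη num α n) (just-injective fms≡m) (computes ms))
  (λ e → cong just (num-injective α (≈trans (≈sym (computes ms)) e)))
  where
  F⁻ = translate as α F
  computes : ∀ ms → applyNums F⁻ ms ≈βη num α (f ms)
  computes ms = begin
    applyNums F⁻ ms              ≈⟨ applyNums-translate as α F ms ⟩
    fillNum α (applyNums F ms)   ≈⟨ fillNum-≈βη α (Equivalence.to (F-defines-f ms (f ms)) refl) ⟩
    fillNum α (num α (f ms))     ≈⟨ fillNum-num α (f ms) ⟩
    num α (f ms)                 ∎
    where open SetoidReasoning (≈βη-setoid NoConst ε (ω α))
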